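{- Let $C$ be an undetermined circuit (as defined in the context) whose input arrival times are integers, and let $\mathrm{weight}(C)=\sum_{i=1}^k 2^{d_i}$, where $d_1,\dots,d_k$ are the arrival times at the predecessors of the output gate of $C$. Then one can construct a Boolean circuit using only \textsc{And} gates and \textsc{Or} gates of fan-in two that computes the same Boolean function as $C$ and has delay at most $\lceil \log_2(\mathrm{weight}(C)) \rceil$.
   Context: A circuit is a connected acyclic directed graph whose nodes are partitioned into inputs (no incoming edges, representing Boolean variables) and gates (each representing an elementary Boolean function, here \textsc{And} or \textsc{Or}), where exactly one gate, the output gate, has no outgoing edges. Each input $t$ has an arrival time $a(t)$. Delay model: every gate takes one time unit and wires take zero time, so the arrival time at a gate is the maximum of the arrival times of its predecessors plus $1$; the delay of a circuit is the arrival time at its output gate. An undetermined circuit is a circuit consisting only of \textsc{And} and \textsc{Or} gates such that every gate other than the output gate has fan-in exactly two (the output gate may have arbitrary fan-in). -}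

module Defs where

open import Data.Nat using (ℕ; zero; suc)
open import Data.Integer as ℤ using (ℤ; +_; -[1+_])
open import Data.Rational as ℚ using (ℚ; ½; 1ℚ)
open import Data.Fin using (Fin; zero; suc)
open import Data.Bool using (Bool; _∧_; _∨_)
open import Data.List using (List; []; _∷_; map; foldr)
open import Data.Bool.ListAction using (and; or)
open import Data.List.Membership.Propositional using (_∈_)
open import Data.List.Relation.Unary.Unique.Propositional using (Unique)
open import Data.Sum using (_⊎_; inj₁; inj₂)
open import Data.Product using (_×_; _,_; proj₁; proj₂; ∃; ∃-syntax)
open import Relation.Binary.PropositionalEquality using (_≡_; _≢_)

data Op : Set where
  AND OR : Op

applyOp : Op → Bool → Bool → Bool
applyOp AND = _∧_
applyOp OR  = _∨_

-- Nodes that can feed a gate: one of the n inputs, or one of g gates.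

Src : ℕ → ℕ → Set
Src n g = Fin n ⊎ Fin g

liftSrc : ∀ {n g} → Src n g → Src n (suc g)
liftSrc (inj₁ i) = inj₁ i
liftSrc (inj₂ j) = inj₂ (suc j)

-- A topologically ordered list of fan-in-two gates over n inputs.
-- In  G ▷ (o , l , r)  the new gate is gate 'zero'; it reads from the
-- inputs and from the gates of G (which become gates 'suc j').
-- Acyclicity holds by construction.
data Gates (n : ℕ) : ℕ → Set where
  []  : Gates n 0
  _▷_ : ∀ {g} → Gates n g → Op × Src n g × Src n g → Gates n (suc g)

-- the two predecessors of a gate, in the coordinates of the whole list
preds : ∀ {n g} → Gates n g → Fin g → Src n g × Src n g
preds (G ▷ (o , l , r)) zero    = liftSrc l , liftSrc r
preds (G ▷ γ)           (suc j) = liftSrc (proj₁ (preds G j)) , liftSrc (proj₂ (preds G j))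

DistinctPreds : ∀ {n g} → Gates n g → Set
DistinctPreds G = ∀ j → proj₁ (preds G j) ≢ proj₂ (preds G j)

FeedsGate : ∀ {n g} → Gates n g → Src n g → Set
FeedsGate G s = ∃[ j ] (s ≡ proj₁ (preds G j) ⊎ s ≡ proj₂ (preds G j))

mutual
  evalSrc : ∀ {n g} → Gates n g → (Fin n → Bool) → Src n g → Bool
  evalSrc G x (inj₁ i) = x i
  evalSrc G x (inj₂ j) = evalGate G x j

  evalGate : ∀ {n g} → Gates n g → (Fin n → Bool) → Fin g → Bool
  evalGate (G ▷ (o , l , r)) x zero    = applyOp o (evalSrc G x l) (evalSrc G x r)
  evalGate (G ▷ γ)           x (suc j) = evalGate G x j

mutual
  arrSrc : ∀ {n g} → Gates n g → (Fin n → ℤ) → Src n g → ℤ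
  arrSrc G a (inj₁ i) = a i
  arrSrc G a (inj₂ j) = arrGate G a j

  arrGate : ∀ {n g} → Gates n g → (Fin n → ℤ) → Fin g → ℤ
  arrGate (G ▷ (o , l , r)) a zero    = ℤ.suc (arrSrc G a l ℤ.⊔ arrSrc G a r)
  arrGate (G ▷ γ)           a (suc j) = arrGate G a j

-- Undetermined circuits: fan-in-two And/Or gates plus an output gate
-- of arbitrary (nonzero) fan-in.

record UCircuit (n : ℕ) : Set where
  field
    size     : ℕ                 -- number of non-output gates
    gates    : Gates n size
    outOp    : Op
    outPreds : List (Src n size)

open UCircuit public

-- Well-formedness: simple digraph (no parallel edges), output gate has at
-- least one predecessor, and every node other than the output gate has an
-- outgoing edge (so the output gate is the unique sink; together with
-- acyclicity-by-construction this makes the graph a connected DAG).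
IsUndetermined : ∀ {n} → UCircuit n → Set
IsUndetermined C =
    DistinctPreds (gates C)
  × Unique (outPreds C)
  × outPreds C ≢ []
  × (∀ (s : Src _ (size C)) → FeedsGate (gates C) s ⊎ s ∈ outPreds C)

evalOp* : Op → List Bool → Bool
evalOp* AND = and
evalOp* OR  = or

evalU : ∀ {n} → UCircuit n → (Fin n → Bool) → Bool
evalU C x = evalOp* (outOp C) (map (evalSrc (gates C) x) (outPreds C))

pow2ℕ : ℕ → ℚ
pow2ℕ zero    = 1ℚ
pow2ℕ (suc k) = pow2ℕ k ℚ.+ pow2ℕ k

pow2 : ℤ → ℚ
pow2 (+ k)    = pow2ℕ k
pow2 -[1+ k ] = ½ ℚ.* negpow k
  where
  negpow : ℕ → ℚ
  negpow zero    = 1ℚ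
  negpow (suc m) = ½ ℚ.* negpow m

weight : ∀ {n} → UCircuit n → (Fin n → ℤ) → ℚ
weight C a = foldr (λ s acc → pow2 (arrSrc (gates C) a s) ℚ.+ acc) (ℚ.0ℚ) (outPreds C)

IsCeilLog2 : ℚ → ℤ → Set
IsCeilLog2 w m = (w ℚ.≤ pow2 m) × (pow2 (m ℤ.- ℤ.1ℤ) ℚ.< w)

-- Boolean circuits with only fan-in-two And/Or gates.  The output is a
-- node (normally the last gate; an input node is allowed to cover the
-- degenerate gate-free circuit).

record Circuit2 (n : ℕ) : Set where
  field
    size2  : ℕ
    gates2 : Gates n size2
    out    : Src n size2

open Circuit2 public

IsCircuit2 : ∀ {n} → Circuit2 n → Set
IsCircuit2 D =
    DistinctPreds (gates2 D)
  × (∀ j → inj₂ j ≢ out D → FeedsGate (gates2 D) (inj₂ j))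

eval2 : ∀ {n} → Circuit2 n → (Fin n → Bool) → Bool
eval2 D x = evalSrc (gates2 D) x (out D)

delay2 : ∀ {n} → Circuit2 n → (Fin n → ℤ) → ℤ
delay2 D a = arrSrc (gates2 D) a (out D)

module Submission where

-- Let b be the least arrival time at the predecessors of the output gate.  Then
-- weight(C) = 2^b · Σ 2^eᵢ with natural exponents eᵢ = dᵢ − b, and the hypothesis says
-- Σ 2^eᵢ ≤ 2^M for M = m − b.  View each predecessor as an open node due by b + eᵢ.
-- One round pairs up the open nodes with eᵢ = 0 by new gates of the output gate's type,
-- which are due by b + 1, and reads every other node as having exponent eᵢ − 1 relative
-- to b + 1; an unpaired node is kept.  The new total w′ satisfies w ≤ 2w′ ≤ w + 1, so
-- w ≤ 2^M gives w′ ≤ 2^(M−1).  After M rounds the total is 1: a single node due by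
-- b + M = m, and it computes the output gate's function because And and Or are
-- associative and commutative.

open import Defs
open import Data.Nat using (ℕ)
open import Data.Integer using (ℤ; _≤_)
open import Data.Fin using (Fin)
open import Data.Bool using (Bool)
open import Data.Product using (_×_; ∃-syntax)
open import Relation.Binary.PropositionalEquality using (_≡_)

open import Data.Nat as ℕ using (zero; suc; _+_; _*_; _^_; z≤n; s≤s)
import Data.Nat.Properties as ℕₚ
import Data.Nat.Tactic.RingSolver as ℕSolver
open import Data.Integer as ℤ using (+_; -[1+_])
import Data.Integer.Properties as ℤₚ
import Data.Integer.Tactic.RingSolver as ℤSolver
open import Data.Rational as ℚ using (ℚ; 0ℚ; 1ℚ; ½)
import Data.Rational.Properties as ℚₚ
open import Data.Fin using (zero; suc)
import Data.Bool.Properties as Boolₚ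
open import Data.List using (List; []; _∷_; _++_; map; foldr; length)
import Data.List.Properties as Listₚ
open import Data.List.Relation.Unary.All as All using (All; []; _∷_)
import Data.List.Relation.Unary.All.Properties as Allₚ
open import Data.List.Relation.Unary.Any using (here; there)
open import Data.List.Relation.Unary.AllPairs using (_∷_)
open import Data.List.Membership.Propositional using (_∈_)
open import Data.List.Membership.Propositional.Properties using (∈-map⁺)
open import Data.List.Relation.Unary.Unique.Propositional using (Unique)
import Data.List.Relation.Unary.Unique.Propositional.Properties as Uniqueₚ
open import Data.List.Relation.Binary.Permutation.Propositional
  using (_↭_; prep; ↭-sym; ↭-trans; ↭-reflexive; ↭⇒↭ₛ)
open import Data.List.Relation.Binary.Permutation.Propositional.Properties
  using (shift; ∈-resp-↭) renaming (map⁺ to ↭-map⁺)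
open import Data.List.Relation.Binary.Permutation.Setoid.Properties
  using (foldr-commMonoid; Unique-resp-↭)
open import Data.List.Extrema ℤₚ.≤-totalOrder using (min; min≤⊤; min≤xs)
open import Data.Sum as Sum using (_⊎_; inj₁; inj₂)
open import Data.Product using (Σ-syntax; _,_; proj₁; proj₂; map₁)
open import Data.Empty using (⊥-elim)
open import Function using (_∘_)
open import Relation.Binary.PropositionalEquality
  using (_≢_; refl; sym; trans; cong; cong₂; subst; subst₂; setoid; module ≡-Reasoning)

fromℕ : ℕ → ℚ
fromℕ zero    = 0ℚ
fromℕ (suc k) = 1ℚ ℚ.+ fromℕ k

fromℕ-+ : ∀ m n → fromℕ (m + n) ≡ fromℕ m ℚ.+ fromℕ n
fromℕ-+ zero    n = sym (ℚₚ.+-identityˡ (fromℕ n))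
fromℕ-+ (suc m) n = trans (cong (1ℚ ℚ.+_) (fromℕ-+ m n)) (sym (ℚₚ.+-assoc 1ℚ (fromℕ m) (fromℕ n)))

fromℕ<fromℕ-suc : ∀ n → fromℕ n ℚ.< fromℕ (suc n)
fromℕ<fromℕ-suc n =
  subst (ℚ._< 1ℚ ℚ.+ fromℕ n) (ℚₚ.+-identityˡ (fromℕ n)) (ℚₚ.+-monoˡ-< (fromℕ n) (ℚₚ.positive⁻¹ 1ℚ))

fromℕ-mono-≤ : ∀ {m n} → m ℕ.≤ n → fromℕ m ℚ.≤ fromℕ n
fromℕ-mono-≤ {n = zero}  z≤n       = ℚₚ.≤-refl
fromℕ-mono-≤ {n = suc n} z≤n       = ℚₚ.≤-trans (fromℕ-mono-≤ {n = n} z≤n) (ℚₚ.<⇒≤ (fromℕ<fromℕ-suc n))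
fromℕ-mono-≤ (s≤s m≤n) = ℚₚ.+-monoʳ-≤ 1ℚ (fromℕ-mono-≤ m≤n)

fromℕ-cancel-≤ : ∀ {m n} → fromℕ m ℚ.≤ fromℕ n → m ℕ.≤ n
fromℕ-cancel-≤ {m} {n} fm≤fn = ℕₚ.≮⇒≥ λ n<m →
  ℚₚ.<-irrefl refl (ℚₚ.≤-<-trans fm≤fn (ℚₚ.<-≤-trans (fromℕ<fromℕ-suc n) (fromℕ-mono-≤ n<m)))

+-suc : ∀ z k → z ℤ.+ + suc k ≡ ℤ.suc z ℤ.+ + k
+-suc z k = lemma z (+ k)
  where
  lemma : ∀ z w → z ℤ.+ (ℤ.1ℤ ℤ.+ w) ≡ (ℤ.1ℤ ℤ.+ z) ℤ.+ w
  lemma = ℤSolver.solve-∀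

i+∣j-i∣≡j : ∀ {i j} → i ≤ j → i ℤ.+ + ℤ.∣ j ℤ.- i ∣ ≡ j
i+∣j-i∣≡j {i} {j} i≤j = begin
  i ℤ.+ + ℤ.∣ j ℤ.- i ∣ ≡⟨ cong (λ w → i ℤ.+ w) (ℤₚ.0≤i⇒+∣i∣≡i (ℤₚ.i≤j⇒0≤j-i i≤j)) ⟩
  i ℤ.+ (j ℤ.- i)       ≡⟨ lemma i j ⟩
  j                     ∎
  where
  open ≡-Reasoning
  lemma : ∀ i j → i ℤ.+ (j ℤ.- i) ≡ j
  lemma = ℤSolver.solve-∀

½*p+½*p≡p : ∀ p → ½ ℚ.* p ℚ.+ ½ ℚ.* p ≡ p
½*p+½*p≡p p = trans (sym (ℚₚ.*-distribʳ-+ p ½ ½)) (ℚₚ.*-identityˡ p)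

pow2-suc : ∀ z → pow2 (ℤ.suc z) ≡ pow2 z ℚ.+ pow2 z
pow2-suc (+ n)        = refl
pow2-suc -[1+ zero ]  = sym (½*p+½*p≡p 1ℚ)
pow2-suc -[1+ suc k ] = sym (½*p+½*p≡p (pow2 -[1+ k ]))

pow2-+ : ∀ z k → pow2 (z ℤ.+ + k) ≡ pow2 z ℚ.* fromℕ (2 ^ k)
pow2-+ z zero = begin
  pow2 (z ℤ.+ + 0)    ≡⟨ cong pow2 (ℤₚ.+-identityʳ z) ⟩
  pow2 z              ≡⟨ ℚₚ.*-identityʳ (pow2 z) ⟨
  pow2 z ℚ.* 1ℚ       ≡⟨ cong (pow2 z ℚ.*_) (ℚₚ.+-identityʳ 1ℚ) ⟨
  pow2 z ℚ.* fromℕ 1  ∎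
  where open ≡-Reasoning
pow2-+ z (suc k) = begin
  pow2 (z ℤ.+ + suc k)              ≡⟨ cong pow2 (+-suc z k) ⟩
  pow2 (ℤ.suc z ℤ.+ + k)            ≡⟨ pow2-+ (ℤ.suc z) k ⟩
  pow2 (ℤ.suc z) ℚ.* q              ≡⟨ cong (ℚ._* q) (pow2-suc z) ⟩
  (pow2 z ℚ.+ pow2 z) ℚ.* q         ≡⟨ ℚₚ.*-distribʳ-+ q (pow2 z) (pow2 z) ⟩
  pow2 z ℚ.* q ℚ.+ pow2 z ℚ.* q     ≡⟨ ℚₚ.*-distribˡ-+ (pow2 z) q q ⟨
  pow2 z ℚ.* (q ℚ.+ q)              ≡⟨ cong (pow2 z ℚ.*_) (fromℕ-+ (2 ^ k) (2 ^ k)) ⟨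
  pow2 z ℚ.* fromℕ (2 ^ k + 2 ^ k)  ≡⟨ cong (λ w → pow2 z ℚ.* fromℕ (2 ^ k + w)) (ℕₚ.+-identityʳ (2 ^ k)) ⟨
  pow2 z ℚ.* fromℕ (2 ^ suc k)      ∎
  where
  open ≡-Reasoning
  q = fromℕ (2 ^ k)

pow2-split : ∀ {b z} → b ≤ z → pow2 z ≡ pow2 b ℚ.* fromℕ (2 ^ ℤ.∣ z ℤ.- b ∣)
pow2-split {b} {z} b≤z = trans (cong pow2 (sym (i+∣j-i∣≡j b≤z))) (pow2-+ b ℤ.∣ z ℤ.- b ∣)

pow2-positive : ∀ z → ℚ.Positive (pow2 z)
pow2-positive (+ k)          = pow2ℕ-positive k
  where
  pow2ℕ-positive : ∀ k → ℚ.Positive (pow2ℕ k)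
  pow2ℕ-positive zero    = _
  pow2ℕ-positive (suc k) =
    ℚₚ.pos+pos⇒pos (pow2ℕ k) {{pow2ℕ-positive k}} (pow2ℕ k) {{pow2ℕ-positive k}}
pow2-positive -[1+ zero ]    = _
pow2-positive -[1+ suc k ]   = ℚₚ.pos*pos⇒pos ½ (pow2 -[1+ k ]) {{pow2-positive -[1+ k ]}}

2*m≤1+2*n⇒m≤n : ∀ {m n} → 2 * m ℕ.≤ suc (2 * n) → m ℕ.≤ n
2*m≤1+2*n⇒m≤n {m} {n} 2m≤1+2n =
  ℕₚ.<⇒≤pred (ℕₚ.*-cancelˡ-< 2 m (suc n) (subst (2 * m ℕ.<_) (sym (ℕₚ.*-suc 2 n)) (s≤s 2m≤1+2n)))

0<m≤2*n⇒0<n : ∀ {m} n → 0 ℕ.< m → m ℕ.≤ 2 * n → 0 ℕ.< n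
0<m≤2*n⇒0<n zero    0<m m≤0 = ⊥-elim (ℕₚ.<-irrefl refl (ℕₚ.<-≤-trans 0<m m≤0))
0<m≤2*n⇒0<n (suc n) _   _   = s≤s z≤n

evalOp*-↭ : ∀ o {bs cs} → bs ↭ cs → evalOp* o bs ≡ evalOp* o cs
evalOp*-↭ AND bs↭cs = foldr-commMonoid (setoid Bool) Boolₚ.∧-isCommutativeMonoid (↭⇒↭ₛ bs↭cs)
evalOp*-↭ OR  bs↭cs = foldr-commMonoid (setoid Bool) Boolₚ.∨-isCommutativeMonoid (↭⇒↭ₛ bs↭cs)

evalOp*-singleton : ∀ o b → evalOp* o (b ∷ []) ≡ b
evalOp*-singleton AND = Boolₚ.∧-identityʳ
evalOp*-singleton OR  = Boolₚ.∨-identityʳ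

evalOp*-applyOp : ∀ o b c ds → evalOp* o (applyOp o b c ∷ ds) ≡ evalOp* o (b ∷ c ∷ ds)
evalOp*-applyOp AND b c ds = Boolₚ.∧-assoc b c _
evalOp*-applyOp OR  b c ds = Boolₚ.∨-assoc b c _

module _ {n g : ℕ} where

  liftSrc-injective : ∀ {s t : Src n g} → liftSrc s ≡ liftSrc t → s ≡ t
  liftSrc-injective {inj₁ i} {inj₁ .i} refl = refl
  liftSrc-injective {inj₂ j} {inj₂ .j} refl = refl

  liftSrc≢newest : ∀ (s : Src n g) → liftSrc s ≢ inj₂ zero
  liftSrc≢newest (inj₁ i) ()
  liftSrc≢newest (inj₂ j) ()

  module _ (G : Gates n g) (γ : Op × Src n g × Src n g) where

    evalSrc-liftSrc : ∀ x s → evalSrc (G ▷ γ) x (liftSrc s) ≡ evalSrc G x s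
    evalSrc-liftSrc x (inj₁ i) = refl
    evalSrc-liftSrc x (inj₂ j) = refl

    arrSrc-liftSrc : ∀ a s → arrSrc (G ▷ γ) a (liftSrc s) ≡ arrSrc G a s
    arrSrc-liftSrc a (inj₁ i) = refl
    arrSrc-liftSrc a (inj₂ j) = refl

    map-evalSrc-liftSrc : ∀ x ss → map (evalSrc (G ▷ γ) x) (map liftSrc ss) ≡ map (evalSrc G x) ss
    map-evalSrc-liftSrc x ss = trans (sym (Listₚ.map-∘ ss)) (Listₚ.map-cong (evalSrc-liftSrc x) ss)

    FeedsGate-liftSrc : ∀ {s} → FeedsGate G s → FeedsGate (G ▷ γ) (liftSrc s)
    FeedsGate-liftSrc (j , inj₁ s≡l) = suc j , inj₁ (cong liftSrc s≡l)
    FeedsGate-liftSrc (j , inj₂ s≡r) = suc j , inj₂ (cong liftSrc s≡r)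

module _ {A : Set} where

  nodes : List (A × ℕ) → List A
  nodes = map proj₁

  load : List (A × ℕ) → ℕ
  load []            = 0
  load ((_ , e) ∷ L) = 2 ^ e + load L

  tag : (A → ℕ) → List A → List (A × ℕ)
  tag e = map (λ s → s , e s)

  units : List (A × ℕ) → List A
  units []                = []
  units ((s , zero) ∷ L)  = s ∷ units L
  units ((s , suc e) ∷ L) = units L

  halves : List (A × ℕ) → List (A × ℕ)
  halves []                = []
  halves ((s , zero) ∷ L)  = halves L
  halves ((s , suc e) ∷ L) = (s , e) ∷ halves L

  nodes-↭ : ∀ L → nodes L ↭ units L ++ nodes (halves L)
  nodes-↭ []                = ↭-reflexive refl
  nodes-↭ ((s , zero) ∷ L)  = prep s (nodes-↭ L)
  nodes-↭ ((s , suc e) ∷ L) = ↭-trans (prep s (nodes-↭ L)) (↭-sym (shift s (units L) (nodes (halves L))))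

  load-halves : ∀ L → load L ≡ length (units L) + 2 * load (halves L)
  load-halves []                = refl
  load-halves ((s , zero) ∷ L)  = cong suc (load-halves L)
  load-halves ((s , suc e) ∷ L) =
    trans (cong (λ w → 2 ^ suc e + w) (load-halves L)) (lemma (2 ^ e) (length (units L)) (load (halves L)))
    where
    lemma : ∀ p u h → 2 * p + (u + 2 * h) ≡ u + 2 * (p + h)
    lemma = ℕSolver.solve-∀

  nodes-tag : ∀ e xs → nodes (tag e xs) ≡ xs
  nodes-tag e xs = trans (sym (Listₚ.map-∘ xs)) (Listₚ.map-id xs)

  load-tag-positive : ∀ e xs → xs ≢ [] → 0 ℕ.< load (tag e xs)
  load-tag-positive e []       xs≢[] = ⊥-elim (xs≢[] refl)
  load-tag-positive e (s ∷ xs) _     = ℕₚ.<-≤-trans (ℕₚ.m^n>0 2 (e s)) (ℕₚ.m≤m+n _ _)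

  load≤1⇒singleton : ∀ L → 0 ℕ.< load L → load L ℕ.≤ 1 → ∃[ s ] L ≡ (s , 0) ∷ []
  load≤1⇒singleton ((s , zero) ∷ [])          _ _            = s , refl
  load≤1⇒singleton ((s , zero) ∷ (t , e) ∷ L) _ (s≤s load≤0) =
    ⊥-elim (ℕₚ.<-irrefl refl (ℕₚ.<-≤-trans (ℕₚ.<-≤-trans (ℕₚ.m^n>0 2 e) (ℕₚ.m≤m+n _ _)) load≤0))
  load≤1⇒singleton ((s , suc e) ∷ L)          _ load≤1       with 2≤1
    where
    2≤1 : 2 ℕ.≤ 1
    2≤1 = ℕₚ.≤-trans (ℕₚ.*-monoʳ-≤ 2 (ℕₚ.m^n>0 2 e)) (ℕₚ.≤-trans (ℕₚ.m≤m+n _ (load L)) load≤1)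
  ... | s≤s ()

  OnTime : (A → ℤ) → ℤ → List (A × ℕ) → Set
  OnTime d b = All (λ item → d (proj₁ item) ≤ b ℤ.+ + proj₂ item)

  module _ (d : A → ℤ) (b : ℤ) where

    units-onTime : ∀ L → OnTime d b L → All (λ s → d s ≤ b) (units L)
    units-onTime []                []               = []
    units-onTime ((s , zero) ∷ L)  (s≤b+0 ∷ onTime) =
      subst (d s ≤_) (ℤₚ.+-identityʳ b) s≤b+0 ∷ units-onTime L onTime
    units-onTime ((s , suc e) ∷ L) (_ ∷ onTime)     = units-onTime L onTime

    halves-onTime : ∀ L → OnTime d b L → OnTime d (ℤ.suc b) (halves L)
    halves-onTime []                []                 = []
    halves-onTime ((s , zero) ∷ L)  (_ ∷ onTime)       = halves-onTime L onTime
    halves-onTime ((s , suc e) ∷ L) (s≤b+1+e ∷ onTime) =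
      subst (d s ≤_) (+-suc b e) s≤b+1+e ∷ halves-onTime L onTime

sum-pow2≡pow2*load : ∀ {A : Set} (d : A → ℤ) b xs → All (λ s → b ≤ d s) xs →
  foldr (λ s acc → pow2 (d s) ℚ.+ acc) 0ℚ xs ≡ pow2 b ℚ.* fromℕ (load (tag (λ s → ℤ.∣ d s ℤ.- b ∣) xs))
sum-pow2≡pow2*load d b []       []               = sym (ℚₚ.*-zeroʳ (pow2 b))
sum-pow2≡pow2*load d b (s ∷ xs) (b≤ds ∷ b≤dxs) = begin
  pow2 (d s) ℚ.+ foldr (λ s acc → pow2 (d s) ℚ.+ acc) 0ℚ xs
    ≡⟨ cong₂ ℚ._+_ (pow2-split b≤ds) (sum-pow2≡pow2*load d b xs b≤dxs) ⟩
  pow2 b ℚ.* fromℕ (2 ^ e s) ℚ.+ pow2 b ℚ.* fromℕ (load (tag e xs))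
    ≡⟨ ℚₚ.*-distribˡ-+ (pow2 b) _ _ ⟨
  pow2 b ℚ.* (fromℕ (2 ^ e s) ℚ.+ fromℕ (load (tag e xs)))
    ≡⟨ cong (pow2 b ℚ.*_) (fromℕ-+ (2 ^ e s) _) ⟨
  pow2 b ℚ.* fromℕ (2 ^ e s + load (tag e xs)) ∎
  where
  open ≡-Reasoning
  e = λ s → ℤ.∣ d s ℤ.- b ∣

module _ {A B : Set} (f : A → B) where

  nodes-map₁ : ∀ L → nodes (map (map₁ f) L) ≡ map f (nodes L)
  nodes-map₁ L = trans (sym (Listₚ.map-∘ L)) (Listₚ.map-∘ L)

  load-map₁ : ∀ L → load (map (map₁ f) L) ≡ load L
  load-map₁ []            = refl
  load-map₁ ((_ , e) ∷ L) = cong (λ w → 2 ^ e + w) (load-map₁ L)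

module Construction {n : ℕ} (op : Op) (f : (Fin n → Bool) → Bool) (a : Fin n → ℤ) where

  record Frontier {g} (G : Gates n g) (xs : List (Src n g)) : Set where
    field
      distinct : DistinctPreds G
      unique   : Unique xs
      computes : ∀ x → evalOp* op (map (evalSrc G x) xs) ≡ f x
      covered  : ∀ j → FeedsGate G (inj₂ j) ⊎ inj₂ j ∈ xs

  Frontier-↭ : ∀ {g} {G : Gates n g} {xs ys} → xs ↭ ys → Frontier G xs → Frontier G ys
  Frontier-↭ {G = G} xs↭ys fr = record
    { distinct = distinct
    ; unique   = Unique-resp-↭ (setoid _) (↭⇒↭ₛ xs↭ys) unique
    ; computes = λ x → trans (sym (evalOp*-↭ op (↭-map⁺ (evalSrc G x) xs↭ys))) (computes x)
    ; covered  = λ j → Sum.map₂ (∈-resp-↭ xs↭ys) (covered j)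
    }
    where open Frontier fr

  Frontier-▷ : ∀ {g} {G : Gates n g} {p s xs} → Frontier G (p ∷ s ∷ xs) →
               Frontier (G ▷ (op , p , s)) (inj₂ zero ∷ map liftSrc xs)
  Frontier-▷ {G = G} {p} {s} {xs} record
    { distinct = distinct ; unique = (p≢s ∷ _) ∷ _ ∷ xs-unique ; computes = computes ; covered = covered }
    = record
    { distinct = λ { zero → p≢s ∘ liftSrc-injective ; (suc j) → distinct j ∘ liftSrc-injective }
    ; unique   = Allₚ.map⁺ (All.universal (λ t → liftSrc≢newest t ∘ sym) xs)
               ∷ Uniqueₚ.map⁺ liftSrc-injective xs-unique
    ; computes = computes′
    ; covered  = covered′
    }
    where
    γ = op , p , s

    computes′ : ∀ x → evalOp* op (map (evalSrc (G ▷ γ) x) (inj₂ zero ∷ map liftSrc xs)) ≡ f x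
    computes′ x = begin
      evalOp* op (applyOp op (evalSrc G x p) (evalSrc G x s) ∷ map (evalSrc (G ▷ γ) x) (map liftSrc xs))
        ≡⟨ cong (λ bs → evalOp* op (_ ∷ bs)) (map-evalSrc-liftSrc G γ x xs) ⟩
      evalOp* op (applyOp op (evalSrc G x p) (evalSrc G x s) ∷ map (evalSrc G x) xs)
        ≡⟨ evalOp*-applyOp op _ _ _ ⟩
      evalOp* op (map (evalSrc G x) (p ∷ s ∷ xs))
        ≡⟨ computes x ⟩
      f x ∎
      where open ≡-Reasoning

    covered′ : ∀ j → FeedsGate (G ▷ γ) (inj₂ j) ⊎ inj₂ j ∈ inj₂ zero ∷ map liftSrc xs
    covered′ zero    = inj₂ (here refl)
    covered′ (suc j) with covered j
    ... | inj₁ feeds                = inj₁ (FeedsGate-liftSrc G γ feeds)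
    ... | inj₂ (here j≡p)           = inj₁ (zero , inj₁ (cong liftSrc j≡p))
    ... | inj₂ (there (here j≡s))   = inj₁ (zero , inj₂ (cong liftSrc j≡s))
    ... | inj₂ (there (there j∈xs)) = inj₂ (there (∈-map⁺ liftSrc j∈xs))

  Result : ℤ → Set
  Result t = ∃[ D ] (IsCircuit2 D × (∀ x → eval2 D x ≡ f x) × delay2 D a ≤ t)

  singleton⇒result : ∀ {g} {G : Gates n g} {s t} → Frontier G (s ∷ []) → arrSrc G a s ≤ t → Result t
  singleton⇒result {g} {G} {s} fr s≤t =
    record { size2 = g ; gates2 = G ; out = s } ,
    (distinct , feeds) ,
    (λ x → trans (sym (evalOp*-singleton op (evalSrc G x s))) (computes x)) ,
    s≤t
    where
    open Frontier fr
    feeds : ∀ j → inj₂ j ≢ s → FeedsGate G (inj₂ j)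
    feeds j j≢s with covered j
    ... | inj₁ feeds      = feeds
    ... | inj₂ (here j≡s) = ⊥-elim (j≢s j≡s)

  record Stage (b : ℤ) : Set where
    constructor stage
    field
      {size}   : ℕ
      partial  : Gates n size
      items    : List (Src n size × ℕ)
      frontier : Frontier partial (nodes items)
      onTime   : OnTime (arrSrc partial a) b items

  open Stage

  Halved : ℤ → ℕ → Set
  Halved b w = Σ[ S ∈ Stage (ℤ.suc b) ] (w ℕ.≤ 2 * load (items S) × 2 * load (items S) ℕ.≤ suc w)

  newest-onTime : ∀ {g} {G : Gates n g} {p s b} → arrSrc G a p ≤ b → arrSrc G a s ≤ b →
                  arrSrc (G ▷ (op , p , s)) a (inj₂ zero) ≤ ℤ.suc b ℤ.+ + 0
  newest-onTime p≤b s≤b = subst (_ ≤_) (sym (ℤₚ.+-identityʳ _)) (ℤₚ.suc-mono (ℤₚ.⊔-lub p≤b s≤b))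

  -- k = length U is the termination measure: the recursive call is on the lifted list.
  pairUp : ∀ k {g b} (G : Gates n g) U D → length U ≡ k →
           Frontier G (U ++ nodes D) → All (λ s → arrSrc G a s ≤ b) U → OnTime (arrSrc G a) (ℤ.suc b) D →
           Halved b (length U + 2 * load D)
  pairUp _ G [] D _ fr [] onD = stage G D fr onD , ℕₚ.≤-refl , ℕₚ.n≤1+n _
  pairUp _ {b = b} G (p ∷ []) D _ fr (p≤b ∷ []) onD =
    stage G ((p , 0) ∷ D) fr (p≤b+1 ∷ onD) ,
    subst (suc (2 * load D) ℕ.≤_) (sym (ℕₚ.*-suc 2 (load D))) (ℕₚ.n≤1+n (suc (2 * load D))) ,
    ℕₚ.≤-reflexive (ℕₚ.*-suc 2 (load D))
    where
    p≤b+1 : arrSrc G a p ≤ ℤ.suc b ℤ.+ + 0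
    p≤b+1 = subst (_ ≤_) (sym (ℤₚ.+-identityʳ _)) (ℤₚ.i≤j⇒i≤1+j p≤b)
  pairUp (suc (suc k)) {b = b} G (p ∷ s ∷ U) D len fr (p≤b ∷ s≤b ∷ U≤b) onD =
    subst (Halved b) load-eq
      (pairUp k G′ (map liftSrc U) D′ len′ (Frontier-↭ perm (Frontier-▷ fr)) U≤b′ onD′)
    where
    γ  = op , p , s
    G′ = G ▷ γ
    D′ = (inj₂ zero , 0) ∷ map (map₁ liftSrc) D

    len′ : length (map liftSrc U) ≡ k
    len′ = trans (Listₚ.length-map liftSrc U) (ℕₚ.suc-injective (ℕₚ.suc-injective len))

    perm : inj₂ zero ∷ map liftSrc (U ++ nodes D) ↭ map liftSrc U ++ nodes D′
    perm = ↭-trans (↭-reflexive (cong (inj₂ zero ∷_) (Listₚ.map-++ liftSrc U (nodes D))))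
           (↭-trans (↭-sym (shift (inj₂ zero) (map liftSrc U) (map liftSrc (nodes D))))
             (↭-reflexive (cong (λ ys → map liftSrc U ++ inj₂ zero ∷ ys) (sym (nodes-map₁ liftSrc D)))))

    U≤b′ : All (λ t → arrSrc G′ a t ≤ b) (map liftSrc U)
    U≤b′ = Allₚ.map⁺ (All.map (λ {t} → subst (_≤ b) (sym (arrSrc-liftSrc G γ a t))) U≤b)

    onD′ : OnTime (arrSrc G′ a) (ℤ.suc b) D′
    onD′ = newest-onTime {G = G} {p} {s} p≤b s≤b ∷ Allₚ.map⁺ (All.map (λ {item} → lifted item) onD)
      where
      lifted : ∀ item → arrSrc G a (proj₁ item) ≤ ℤ.suc b ℤ.+ + proj₂ item →
               arrSrc G′ a (liftSrc (proj₁ item)) ≤ ℤ.suc b ℤ.+ + proj₂ item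
      lifted (s , _) = subst (_≤ _) (sym (arrSrc-liftSrc G γ a s))

    load-eq : length (map liftSrc U) + 2 * load D′ ≡ 2 + length U + 2 * load D
    load-eq = trans (cong₂ (λ u d → u + 2 * (1 + d)) (Listₚ.length-map liftSrc U) (load-map₁ liftSrc D))
                    (lemma (length U) (load D))
      where
      lemma : ∀ u d → u + 2 * (1 + d) ≡ 2 + u + 2 * d
      lemma = ℕSolver.solve-∀

  halve : ∀ {b} (S : Stage b) → Halved b (load (items S))
  halve {b} (stage G L fr onL) =
    subst (Halved b) (sym (load-halves L))
      (pairUp _ G (units L) (halves L) refl (Frontier-↭ (nodes-↭ L) fr) 
              (units-onTime (arrSrc G a) b L onL) (halves-onTime (arrSrc G a) b L onL))

  build : ∀ M {b} (S : Stage b) → 0 ℕ.< load (items S) → load (items S) ℕ.≤ 2 ^ M → Result (b ℤ.+ + M)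
  build zero (stage G L fr onL) pos load≤1 with load≤1⇒singleton L pos load≤1
  ... | s , refl = singleton⇒result fr (All.head onL)
  build (suc M) {b} S pos load≤2^M with halve S
  ... | S′ , lower , upper =
    subst Result (sym (+-suc b M))
      (build M S′ (0<m≤2*n⇒0<n _ pos lower) (2*m≤1+2*n⇒m≤n (ℕₚ.≤-trans upper (s≤s load≤2^M))))

mainTheorem1 : ∀ {n : ℕ} (C : UCircuit n) (a : Fin n → ℤ) → IsUndetermined C →
    ∀ (m : ℤ) → IsCeilLog2 (weight C a) m →
    ∃[ D ] (IsCircuit2 D × (∀ (x : Fin n → Bool) → eval2 D x ≡ evalU C x) × delay2 D a ≤ m)
mainTheorem1 {n} C a (distinct , unique , nonEmpty , covered) m (weight≤2^m , _) =
  subst Result (i+∣j-i∣≡j b≤m)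
    (build M {b} (stage G L frontier onTime) (load-tag-positive e xs nonEmpty) load≤2^M)
  where
  open Construction (outOp C) (evalU C) a
  G  = gates C
  xs = outPreds C
  d  = arrSrc G a
  -- Seeding the minimum with m makes b ≤ m, so that M = m − b is a natural number.
  b  = min m (map d xs)
  b≤m : b ≤ m
  b≤m = min≤⊤ m (map d xs)
  b≤d : All (λ s → b ≤ d s) xs
  b≤d = Allₚ.map⁻ (min≤xs m (map d xs))
  e : Src n (size C) → ℕ
  e s = ℤ.∣ d s ℤ.- b ∣
  M = ℤ.∣ m ℤ.- b ∣
  L = tag e xs

  frontier : Frontier G (nodes L)
  frontier = subst (Frontier G) (sym (nodes-tag e xs))
    record { distinct = distinct ; unique = unique ; computes = λ x → refl ; covered = λ j → covered (inj₂ j) }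

  onTime : OnTime d b L
  onTime = Allₚ.map⁺ (All.map (λ b≤ds → ℤₚ.≤-reflexive (sym (i+∣j-i∣≡j b≤ds))) b≤d)

  load≤2^M : load L ℕ.≤ 2 ^ M
  load≤2^M = fromℕ-cancel-≤ (ℚₚ.*-cancelˡ-≤-pos (pow2 b) {{pow2-positive b}}
    (subst₂ ℚ._≤_ (sum-pow2≡pow2*load d b xs b≤d) (pow2-split b≤m) weight≤2^m))
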